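{- Let $\mathcal{A}=(S,\Gamma,\delta,\bot,s_0,f)$ be a 0-C1PVASS all of whose counter updates lie in $\{ -1,0,+1\}$, and let $\mathcal{P}'$ be the pushdown automaton over the unary alphabet $\{a\}$ constructed from $\mathcal{A}$ as described in the context. Then for every $m\in\mathbb{N}$, $a^m\in L(\mathcal{P}')$ if and only if $\mathcal{A}$ has an accepting run (a run ending in state $f$) with exactly $m$ transitions carrying a $+1$ counter update.
   Context: A 0-C1PVASS is a tuple $\mathcal{A}=(S,\Gamma,\delta,\bot,s_0,f)$: finite state set $S$, finite stack alphabet $\Gamma\ni\bot$, initial state $s_0$, accepting state $f$, and a partial function $\delta:S\times S\rightharpoonup\mathbb{Z}\times(\{b,\overline{b}\mid b\in\Gamma\setminus\{\bot\}\}\cup\{\epsilon\})$ giving a counter update and a stack operation (push $b$, pop $b$, or none). Configurations are $(s,\alpha,c)$ with $\alpha\in\Gamma^*$ and $c\in\mathbb{R}_{\ge0}$; the initial one is $(s_0,\bot,0)$. A run is a sequence of configurations starting in the initial configuration where consecutive states are linked by a defined transition $(z,op)$, the stack is updated according to $op$, and the counter changes by $\gamma z$ for some $\gamma\in(0,1]$, always staying $\ge 0$. Construction of $\mathcal{P}'$: its states are two copies $S\times\{0,1\}$; initial state $(s_0,0)$; accepting states $(f,0)$ and $(f,1)$; initial stack symbol $\bot$. For each transition $p\to q$ of $\mathcal{A}$ with update $z$ and stack operation $op$: if $z=0$, $\mathcal{P}'$ has transitions $(p,0)\to(q,0)$ and $(p,1)\to(q,1)$ with operation $op$; if $z=+1$,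 it has transitions $(p,0)\to(q,1)$ and $(p,1)\to(q,1)$ with operation $op$; if $z=-1$, it has a transition $(p,1)\to(q,1)$ with operation $op$. Transitions originating from $+1$ updates read the letter $a$, all others read the empty word. $L(\mathcal{P}')$ is the set of words read by runs of $\mathcal{P}'$ from $((s_0,0),\bot)$ ending in an accepting state.
   Formalization: The counter values c and the scaling factors γ in runs of $\mathcal{A}$ are rational rather than real. -}

module Defs where

open import Data.Nat using (ℕ; zero; suc)
open import Data.Sum using (_⊎_)
open import Data.Fin using (Fin)
open import Data.Bool using (Bool; true; false; if_then_else_)
open import Data.Maybe using (Maybe; just; nothing)
open import Data.Unit using (⊤; tt)
open import Data.List using (List; []; _∷_; replicate; _++_)
open import Data.Product using (Σ; ∃; _×_; _,_)
open import Data.Integer as ℤ using (ℤ; +_; -[1+_])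
open import Data.Rational as ℚ using (ℚ; 0ℚ; 1ℚ)
open import Relation.Binary.PropositionalEquality using (_≡_)
open import Relation.Nullary using (does)

-- Stack alphabet Γ = Fin (suc k), with ⊥ = zero; the non-⊥ symbols
-- are the elements  suc b  for b : Fin k.

⊥Γ : {k : ℕ} → Fin (suc k)
⊥Γ = Fin.zero

data Op (k : ℕ) : Set where
  push : Fin k → Op k
  pop  : Fin k → Op k
  nop  : Op k

Stack : ℕ → Set
Stack k = List (Fin (suc k))      -- head of the list = top of stack

data StackUpd {k : ℕ} : Op k → Stack k → Stack k → Set where
  push-upd : ∀ b α → StackUpd (push b) α (Fin.suc b ∷ α)
  pop-upd  : ∀ b α → StackUpd (pop b) (Fin.suc b ∷ α) α
  nop-upd  : ∀ α → StackUpd nop α α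

record C1PVASS (n k : ℕ) : Set where
  field
    δ  : Fin n → Fin n → Maybe (ℤ × Op k)
    s₀ : Fin n
    f  : Fin n

UnitUpdates : {n k : ℕ} → C1PVASS n k → Set
UnitUpdates {n} {k} A = ∀ (p q : Fin n) (z : ℤ) (op : Op k) →
  C1PVASS.δ A p q ≡ just (z , op) → (z ≡ -[1+ 0 ]) ⊎ (z ≡ + 0) ⊎ (z ≡ + 1)
  
-- configurations (s, α, c); the counter takes nonnegative values
-- (rationals are used in place of reals)
Config : ℕ → ℕ → Set
Config n k = Fin n × Stack k × ℚ

toℚ : ℤ → ℚ
toℚ z = z ℚ./ 1

data Step {n k : ℕ} (A : C1PVASS n k) : ℤ → Config n k → Config n k → Set where
  step : ∀ {s s' α α' c c' z op} (γ : ℚ) →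
         C1PVASS.δ A s s' ≡ just (z , op) →
         StackUpd op α α' →
         0ℚ ℚ.< γ → γ ℚ.≤ 1ℚ →
         c' ≡ c ℚ.+ γ ℚ.* toℚ z →
         0ℚ ℚ.≤ c' →
         Step A z (s , α , c) (s' , α' , c')

plusCount : ℤ → ℕ
plusCount z = if does (z ℤ.≟ + 1) then 1 else 0

data Runs {n k : ℕ} (A : C1PVASS n k) : ℕ → Config n k → Set where
  init : Runs A 0 (C1PVASS.s₀ A , ⊥Γ ∷ [] , 0ℚ)
  next : ∀ {m z C C'} → Runs A m C → Step A z C C' →
         Runs A (plusCount z Data.Nat.+ m) C'

HasAcceptingRun : {n k : ℕ} → C1PVASS n k → ℕ → Set
HasAcceptingRun A m = ∃ λ α → ∃ λ c → Runs A m (C1PVASS.f A , α , c)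

record PDA (Q Σ' : Set) (k : ℕ) : Set₁ where
  field
    Δ      : Q → Maybe Σ' → Op k → Q → Set
    q₀     : Q
    Accept : Q → Set

letter : {Σ' : Set} → Maybe Σ' → List Σ'
letter nothing  = []
letter (just a) = a ∷ []

data PReach {Q Σ' : Set} {k : ℕ} (P : PDA Q Σ' k) : List Σ' → Q × Stack k → Set where
  init : PReach P [] (PDA.q₀ P , ⊥Γ ∷ [])
  next : ∀ {w q q' α α' x op} → PReach P w (q , α) →
         PDA.Δ P q x op q' → StackUpd op α α' →
         PReach P (w ++ letter x) (q' , α')

InL : {Q Σ' : Set} {k : ℕ} → PDA Q Σ' k → List Σ' → Set
InL {Q} P w = Σ Q λ q → ∃ λ α → PReach P w (q , α) × PDA.Accept P q

-- The construction of P' (unary alphabet {a} represented by ⊤, a = tt;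
-- copy 0 = false, copy 1 = true)

data Δ' {n k : ℕ} (A : C1PVASS n k) :
        Fin n × Bool → Maybe ⊤ → Op k → Fin n × Bool → Set where
  zero-tr  : ∀ {p q op} (b : Bool) → C1PVASS.δ A p q ≡ just (+ 0 , op) →
             Δ' A (p , b) nothing op (q , b)
  plus-tr  : ∀ {p q op} (b : Bool) → C1PVASS.δ A p q ≡ just (+ 1 , op) →
             Δ' A (p , b) (just tt) op (q , true)
  minus-tr : ∀ {p q op} → C1PVASS.δ A p q ≡ just (-[1+ 0 ] , op) →
             Δ' A (p , true) nothing op (q , true)

data AcceptP' {n k : ℕ} (A : C1PVASS n k) : Fin n × Bool → Set where
  acc : (b : Bool) → AcceptP' A (C1PVASS.f A , b)

P' : {n k : ℕ} → C1PVASS n k → PDA (Fin n × Bool) ⊤ k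
P' A = record { Δ = Δ' A ; q₀ = (C1PVASS.s₀ A , false) ; Accept = AcceptP' A }

{-# OPTIONS --safe #-}
-- The copy bit of P' records whether the counter has been incremented yet.  A run
-- of A never decrements at counter 0, so it is in copy 1 whenever it decrements,
-- and it lifts to P'.  Conversely, A simulates a run of P' keeping the counter at 0
-- in copy 0 and inside (0,1) in copy 1: by density of ℚ there is always room to
-- increment below 1 or to decrement above 0, and γ is the distance moved.
module Submission where

open import Defs
open import Data.Nat using (ℕ; zero; suc)
import Data.Nat as ℕ
import Data.Nat.Properties as ℕ
open import Data.Unit using (⊤; tt)
open import Data.Bool using (Bool; true; false)
open import Data.Maybe using (just)
open import Data.List using (_∷_; _++_; replicate; length)
open import Data.List.Properties using (length-++; length-replicate)
open import Data.Product using (∃; ∃₂; _×_; _,_; proj₁)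
open import Data.Sum using (inj₁; inj₂)
open import Data.Empty using (⊥-elim)
open import Data.Integer using (ℤ; +_; -[1+_])
open import Data.Rational using (ℚ; 0ℚ; 1ℚ; _+_; _*_; -_; _-_; _<_; _≤_)
import Data.Rational.Properties as ℚ
open import Data.Rational.Solver using (module +-*-Solver)
open import Relation.Binary.PropositionalEquality
open import Function.Bundles using (_⇔_; mk⇔)

open +-*-Solver using (solve; _:+_; _:*_; _:-_; :-_; con; _:=_)

p<q⇒0<q-p : ∀ {p q} → p < q → 0ℚ < q - p
p<q⇒0<q-p {p} {q} p<q = subst (_< q - p) (ℚ.+-inverseʳ p) (ℚ.+-monoˡ-< (- p) p<q)

p-q≤p : ∀ {p q} → 0ℚ ≤ q → p - q ≤ p
p-q≤p {p} {q} 0≤q = subst (p - q ≤_) (ℚ.+-identityʳ p) (ℚ.+-monoʳ-≤ p (ℚ.neg-antimono-≤ 0≤q))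

replicate-++ : ∀ {a} {A : Set a} m n (x : A) → replicate m x ++ replicate n x ≡ replicate (m ℕ.+ n) x
replicate-++ zero    n x = refl
replicate-++ (suc m) n x = cong (x ∷_) (replicate-++ m n x)

record Scaling (z : ℤ) (c c' : ℚ) : Set where
  constructor scaling
  field
    γ   : ℚ
    0<γ : 0ℚ < γ
    γ≤1 : γ ≤ 1ℚ
    c'≡ : c' ≡ c + γ * toℚ z

scaling-zero : ∀ c → Scaling (+ 0) c c
scaling-zero c = scaling 1ℚ (ℚ.positive⁻¹ 1ℚ) ℚ.≤-refl
  (solve 1 (λ c → c := c :+ con 1ℚ :* con 0ℚ) refl c)

scaling-up : ∀ {c c'} → c < c' → c' - c ≤ 1ℚ → Scaling (+ 1) c c'
scaling-up {c} {c'} c<c' dist≤1 = scaling (c' - c) (p<q⇒0<q-p c<c') dist≤1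
  (solve 2 (λ c c' → c' := c :+ (c' :- c) :* con 1ℚ) refl c c')

scaling-down : ∀ {c c'} → c' < c → c - c' ≤ 1ℚ → Scaling -[1+ 0 ] c c'
scaling-down {c} {c'} c'<c dist≤1 = scaling (c - c') (p<q⇒0<q-p c'<c) dist≤1
  (solve 2 (λ c c' → c' := c :+ (c :- c') :* (:- con 1ℚ)) refl c c')

Scaling-zero⇒≡ : ∀ {c c'} → Scaling (+ 0) c c' → c' ≡ c
Scaling-zero⇒≡ {c} (scaling γ _ _ refl) = solve 2 (λ c γ → c :+ γ :* con 0ℚ := c) refl c γ

Scaling-down-from-0⇒<0 : ∀ {c'} → Scaling -[1+ 0 ] 0ℚ c' → c' < 0ℚ
Scaling-down-from-0⇒<0 (scaling γ 0<γ _ refl) =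
  subst (_< 0ℚ) (solve 1 (λ γ → :- γ := con 0ℚ :+ γ :* (:- con 1ℚ)) refl γ) (ℚ.neg-antimono-< 0<γ)

module _ {n k : ℕ} (A : C1PVASS n k) where

  open C1PVASS A

  scaled-step : ∀ {s s' α α' c c' z op} → δ s s' ≡ just (z , op) → StackUpd op α α' →
    Scaling z c c' → 0ℚ ≤ c' → Step A z (s , α , c) (s' , α' , c')
  scaled-step δ≡ upd (scaling γ 0<γ γ≤1 c'≡) 0≤c' = step γ δ≡ upd 0<γ γ≤1 c'≡ 0≤c'

  Step⇒Scaling : ∀ {z s s' α α' c c'} → Step A z (s , α , c) (s' , α' , c') → Scaling z c c'
  Step⇒Scaling (step γ _ _ 0<γ γ≤1 c'≡ _) = scaling γ 0<γ γ≤1 c'≡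

  SmallCounter : Bool → ℚ → Set
  SmallCounter false c = c ≡ 0ℚ
  SmallCounter true  c = 0ℚ < c × c < 1ℚ

  SmallCounter-bounds : ∀ {b c} → SmallCounter b c → 0ℚ ≤ c × c < 1ℚ
  SmallCounter-bounds {false} refl         = ℚ.≤-refl , ℚ.positive⁻¹ 1ℚ
  SmallCounter-bounds {true}  (0<c , c<1) = ℚ.<⇒≤ 0<c , c<1

  simulate-transition : ∀ {p q b b' x op α α' c} → Δ' A (p , b) x op (q , b') →
    StackUpd op α α' → SmallCounter b c →
    ∃₂ λ z c' → Step A z (p , α , c) (q , α' , c') × plusCount z ≡ length (letter x) × SmallCounter b' c'
  simulate-transition {c = c} (zero-tr b δ≡) upd small =
    + 0 , c , scaled-step δ≡ upd (scaling-zero c) (proj₁ (SmallCounter-bounds small)) , refl , small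
  simulate-transition {c = c} (plus-tr b δ≡) upd small with SmallCounter-bounds small
  ... | 0≤c , c<1 with ℚ.<-dense c<1
  ... | c' , c<c' , c'<1 =
    + 1 , c' , scaled-step δ≡ upd (scaling-up c<c' dist≤1) (ℚ.<⇒≤ 0<c') , refl , 0<c' , c'<1
    where
    0<c' : 0ℚ < c'
    0<c' = ℚ.≤-<-trans 0≤c c<c'
    dist≤1 : c' - c ≤ 1ℚ
    dist≤1 = ℚ.≤-trans (p-q≤p 0≤c) (ℚ.<⇒≤ c'<1)
  simulate-transition {c = c} (minus-tr δ≡) upd (0<c , c<1) with ℚ.<-dense 0<c
  ... | c' , 0<c' , c'<c =
    -[1+ 0 ] , c' , scaled-step δ≡ upd (scaling-down c'<c dist≤1) (ℚ.<⇒≤ 0<c') , refl , 0<c' , ℚ.<-trans c'<c c<1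
    where
    dist≤1 : c - c' ≤ 1ℚ
    dist≤1 = ℚ.≤-trans (p-q≤p (ℚ.<⇒≤ 0<c')) (ℚ.<⇒≤ c<1)

  simulate-run : ∀ {w s b α} → PReach (P' A) w ((s , b) , α) →
    ∃ λ c → Runs A (length w) (s , α , c) × SmallCounter b c
  simulate-run init = 0ℚ , init , refl
  simulate-run (next {w} {x = x} reach t upd) with simulate-run reach
  ... | c , run , small with simulate-transition t upd small
  ... | z , c' , st , count , small' = c' , subst (λ m → Runs A m _) run-length (next run st) , small'
    where
    run-length : plusCount z ℕ.+ length w ≡ length (w ++ letter x)
    run-length = begin
      plusCount z ℕ.+ length w        ≡⟨ cong (ℕ._+ length w) count ⟩
      length (letter x) ℕ.+ length w  ≡⟨ ℕ.+-comm (length (letter x)) (length w) ⟩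
      length w ℕ.+ length (letter x)  ≡⟨ length-++ w ⟨
      length (w ++ letter x)          ∎
      where open ≡-Reasoning

  ZeroInCopy₀ : Bool → ℚ → Set
  ZeroInCopy₀ false c = c ≡ 0ℚ
  ZeroInCopy₀ true  c = ⊤

  lift-step : UnitUpdates A → ∀ {w p q b α α' c c' z} → Step A z (p , α , c) (q , α' , c') →
    PReach (P' A) w ((p , b) , α) → ZeroInCopy₀ b c →
    ∃ λ b' → PReach (P' A) (w ++ replicate (plusCount z) tt) ((q , b') , α') × ZeroInCopy₀ b' c'
  lift-step unit {b = b} st@(step {s} {s'} {z = z} {op} _ δ≡ upd _ _ _ _) reach zero₀
    with unit s s' z op δ≡ | Step⇒Scaling st
  ... | inj₂ (inj₁ refl) | sc =
    b , next reach (zero-tr b δ≡) upd , subst (ZeroInCopy₀ b) (sym (Scaling-zero⇒≡ sc)) zero₀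
  ... | inj₂ (inj₂ refl) | _  = true , next reach (plus-tr b δ≡) upd , tt
  lift-step unit {b = true}  (step _ δ≡ upd _ _ _ _) reach _ | inj₁ refl | _ =
    true , next reach (minus-tr δ≡) upd , tt
  lift-step unit {b = false} (step _ _ _ _ _ _ 0≤c') _ refl  | inj₁ refl | sc =
    ⊥-elim (ℚ.<-irrefl refl (ℚ.≤-<-trans 0≤c' (Scaling-down-from-0⇒<0 sc)))

  lift-run : UnitUpdates A → ∀ {m s α c} → Runs A m (s , α , c) →
    ∃ λ b → PReach (P' A) (replicate m tt) ((s , b) , α) × ZeroInCopy₀ b c
  lift-run unit init = false , init , refl
  lift-run unit (next {m} {z} {_ , _ , _} run st) with lift-run unit run
  ... | b , reach , zero₀ with lift-step unit st reach zero₀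
  ... | b' , reach' , zero₀' = b' , subst (λ w → PReach (P' A) w _) word reach' , zero₀'
    where
    word : replicate m tt ++ replicate (plusCount z) tt ≡ replicate (plusCount z ℕ.+ m) tt
    word = trans (replicate-++ m (plusCount z) tt) (cong (λ j → replicate j tt) (ℕ.+-comm m (plusCount z)))

lemma3p6 : {n k : ℕ} (A : C1PVASS n k) → UnitUpdates A →
    (m : ℕ) → InL (P' A) (replicate m tt) ⇔ HasAcceptingRun A m
lemma3p6 A unit m = mk⇔ accepted⇒run run⇒accepted
  where
  accepted⇒run : InL (P' A) (replicate m tt) → HasAcceptingRun A m
  accepted⇒run (_ , α , reach , acc b) with simulate-run A reach
  ... | c , run , _ = α , c , subst (λ j → Runs A j _) (length-replicate m) run

  run⇒accepted : HasAcceptingRun A m → InL (P' A) (replicate m tt)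
  run⇒accepted (α , c , run) with lift-run A unit run
  ... | b , reach , _ = _ , α , reach , acc b
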